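{- For every integer $k\ge2$ (not necessarily a prime power) and $n=k^2$, $\theta^{c}(\mathcal{K}_{n,n,n})=2n$, where $\mathcal{K}_{n,n,n}$ is the complete tripartite graph with three parts of size $n$.
   Context: Graphs are finite, simple and undirected. For a graph $\mathcal{G}=(\mathcal{V},\mathcal{E})$ and positive integers $\alpha,\beta$, an $(\alpha\mid\beta)$-cointersection representation (CIR) of $\mathcal{G}$ consists of two disjoint finite sets of features $\mathcal{A},\mathcal{B}$ with $|\mathcal{A}|=\alpha$, $|\mathcal{B}|=\beta$, together with an assignment to each vertex $v$ of subsets $A_v\subseteq\mathcal{A}$, $B_v\subseteq\mathcal{B}$ (possibly empty), such that for all distinct $u,v\in\mathcal{V}$: $(u,v)\in\mathcal{E}$ if and only if $A_u\cap A_v\neq\varnothing$ and $B_u\cap B_v\neq\varnothing$. The cointersection number $\theta^{c}(\mathcal{G})$ is the minimum of $\alpha+\beta$ over all CIRs of $\mathcal{G}$. -}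

module Defs where

open import Data.Nat using (ℕ; _+_; _*_; _≤_)
open import Data.Fin using (Fin)
open import Data.Fin.Subset using (Subset; _∈_)
open import Data.Product using (Σ; _×_; _,_; ∃-syntax)
open import Relation.Binary.PropositionalEquality using (_≡_)
open import Relation.Nullary using (¬_)
open import Function.Bundles using (_⇔_)
open import Level using (0ℓ)
open import Relation.Binary.PropositionalEquality using (_≢_)

record Graph : Set₁ where
  field
    N     : ℕ
    Adj   : Fin N → Fin N → Set
    sym   : ∀ {u v} → Adj u v → Adj v u
    irrefl : ∀ {u} → ¬ Adj u u

open Graph public

Meets : ∀ {m} → Subset m → Subset m → Set
Meets {m} X Y = ∃[ x ] (x ∈ X × x ∈ Y)

-- An (α | β)-cointersection representation of G: feature sets are Fin α and Fin β
-- (disjoint by construction, as they are distinct sets of features).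
record CIR (G : Graph) (α β : ℕ) : Set where
  field
    A : Fin (N G) → Subset α
    B : Fin (N G) → Subset β
    correct : ∀ u v → u ≢ v → (Adj G u v ⇔ (Meets (A u) (A v) × Meets (B u) (B v)))

CointersectionNumber : Graph → ℕ → Set
CointersectionNumber G t =
  (Σ ℕ λ α → Σ ℕ λ β → CIR G α β × α + β ≡ t)
  × (∀ α β → CIR G α β → t ≤ α + β)

open import Data.Fin using (toℕ)
open import Data.Nat.DivMod using (_/_)
open import Data.Nat using (NonZero)

K3 : (n : ℕ) → .{{NonZero n}} → Graph
K3 n = record
  { N = 3 * n
  ; Adj = λ u v → toℕ u / n ≢ toℕ v / n
  ; sym = λ p q → p (Relation.Binary.PropositionalEquality.sym q)
  ; irrefl = λ p → p Relation.Binary.PropositionalEquality.refl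
  }

module Submission where

-- Take two parts I, J of K_{n,n,n}.  Every edge between I and J is
-- witnessed by a feature pair (a , b) ∈ 𝒜 × ℬ carried by both endpoints; two vertices
-- of one part can never carry a common pair, since they would then be adjacent.  So
-- choosing a witness for every edge of the biclique I × J gives an injection into
-- 𝒜 × ℬ, whence n² ≤ αβ, and by the AM-GM inequality 2n ≤ α + β.
--
-- An orthogonal array with three columns over k symbols on N rows
-- (three functions Fin N → Fin k, any two of which are jointly surjective onto
-- Fin k × Fin k) yields an (N | N)-CIR of K_{k²,k²,k²}: a vertex of part c with
-- index (i , j) gets the fibres {x | coord c x ≡ i} and {x | coord c x ≡ j}.  The
-- cyclic Latin square (row, column, row + column mod k) is such an array with
-- N = k², for every k ≥ 1, so α = β = n works.

open import Defs hiding (sym)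
open import Data.Nat using (ℕ; _+_; _*_; _∸_; _≤_; NonZero)
open import Data.Nat.Properties
open import Data.Nat.Divisibility using (m∣m*n)
open import Data.Nat.DivMod
open import Data.Nat.Tactic.RingSolver using (solve-∀)
open import Data.Fin as Fin using (Fin; toℕ; combine; remQuot; quotient; remainder)
open import Data.Fin.Patterns using (0F; 1F; 2F)
import Data.Fin.Properties as FinP
open import Data.Fin.Subset using (Subset; _∈_)
open import Data.Vec using (tabulate)
open import Data.Vec.Properties using (lookup∘tabulate; lookup⇒[]=; []=⇒lookup)
open import Data.Product.Properties using (,-injective)
open import Data.Product using (Σ; _×_; _,_; proj₁; proj₂; ∃-syntax; uncurry; map₂; swap)
open import Data.Sum using (inj₁; inj₂)
open import Data.Empty using (⊥-elim)
open import Relation.Nullary using (¬_; yes; no; contradiction)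
open import Relation.Nullary.Decidable using (⌊_⌋; toWitness; fromWitness)
open import Data.Bool.Properties using (T-≡)
open import Relation.Binary.PropositionalEquality
open import Function using (_∘_)
open import Function.Bundles using (_⇔_; mk⇔; Equivalence)
open import Function.Definitions using (Injective)

-- AM-GM for natural numbers with a ≤ b: writing b = a + d, (a + b)² = 4ab + d².
am-gm-ordered : ∀ {a b} → a ≤ b → 4 * (a * b) ≤ (a + b) * (a + b)
am-gm-ordered {a} a≤b with d , refl ← m≤n⇒∃[o]m+o≡n a≤b =
  subst (4 * (a * (a + d)) ≤_) (sym (expand a d)) (m≤m+n _ (d * d))
  where
    expand : ∀ a d → (a + (a + d)) * (a + (a + d)) ≡ 4 * (a * (a + d)) + d * d
    expand = solve-∀

am-gm : ∀ a b → 4 * (a * b) ≤ (a + b) * (a + b)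
am-gm a b with ≤-total a b
... | inj₁ a≤b = am-gm-ordered a≤b
... | inj₂ b≤a = subst₂ _≤_ (cong (4 *_) (*-comm b a)) (cong₂ _*_ (+-comm b a) (+-comm b a))
                   (am-gm-ordered b≤a)

-- If n² ≤ ab then 2n ≤ a + b: otherwise (a + b)² < (2n)² = 4n² ≤ 4ab ≤ (a + b)².
square-bound : ∀ n a b → n * n ≤ a * b → 2 * n ≤ a + b
square-bound n a b n²≤ab = ≮⇒≥ λ a+b<2n → <⇒≱ (*-mono-< a+b<2n a+b<2n) 4n²≤[a+b]²
  where
    four-squares : ∀ n → (2 * n) * (2 * n) ≡ 4 * (n * n)
    four-squares = solve-∀

    4n²≤[a+b]² : (2 * n) * (2 * n) ≤ (a + b) * (a + b)
    4n²≤[a+b]² = begin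
      (2 * n) * (2 * n)  ≡⟨ four-squares n ⟩
      4 * (n * n)        ≤⟨ *-monoʳ-≤ 4 n²≤ab ⟩
      4 * (a * b)        ≤⟨ am-gm a b ⟩
      (a + b) * (a + b)  ∎
      where open ≤-Reasoning

remQuot-injective : ∀ {m n} {x y : Fin (m * n)} → remQuot {m} n x ≡ remQuot n y → x ≡ y
remQuot-injective {m} {n} {x} {y} e =
  trans (sym (FinP.combine-remQuot {m} n x))
        (trans (cong (uncurry (combine {m})) e) (FinP.combine-remQuot {m} n y))

-- An injection Fin p × Fin q ↪ Fin a × Fin b forces pq ≤ ab (transport it along
-- Fin (p * q) ≅ Fin p × Fin q and apply the pigeonhole principle).
product-injection-bound : ∀ {p q a b} (f : Fin p × Fin q → Fin a × Fin b) →
  Injective _≡_ _≡_ f → p * q ≤ a * b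
product-injection-bound {p} {q} {a} {b} f f-inj = FinP.injective⇒≤ {f = g} g-inj
  where
    g : Fin (p * q) → Fin (a * b)
    g = uncurry combine ∘ f ∘ remQuot {p} q

    combine-injective : ∀ {m n} {u v : Fin m × Fin n} →
      uncurry combine u ≡ uncurry combine v → u ≡ v
    combine-injective {u = i , j} {k , l} e = uncurry (cong₂ _,_) (FinP.combine-injective i j k l e)

    g-inj : Injective _≡_ _≡_ g
    g-inj = remQuot-injective {p} ∘ f-inj ∘ combine-injective {a}

record IndependentSet (G : Graph) (p : ℕ) : Set where
  field
    vertex      : Fin p → Fin (N G)
    injective   : Injective _≡_ _≡_ vertex
    independent : ∀ i i' → ¬ Adj G (vertex i) (vertex i')

open IndependentSet

adjacent⇒distinct : ∀ {G : Graph} {u v} → Adj G u v → u ≢ v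
adjacent⇒distinct {G} adj refl = irrefl G adj

module _ {G : Graph} {α β} (R : CIR G α β) where
  open CIR R

  Carries : Fin (N G) → Fin α × Fin β → Set
  Carries u (a , b) = a ∈ A u × b ∈ B u

  edge-witness : ∀ {u v} → Adj G u v → Σ (Fin α × Fin β) λ ab → Carries u ab × Carries v ab
  edge-witness {u} {v} adj with Equivalence.to (correct u v (adjacent⇒distinct {G} adj)) adj
  ... | (a , a∈u , a∈v) , (b , b∈u , b∈v) = (a , b) , (a∈u , b∈u) , (a∈v , b∈v)

  common-pair⇒adjacent : ∀ {u v ab} → u ≢ v → Carries u ab → Carries v ab → Adj G u v
  common-pair⇒adjacent {u} {v} u≢v (a∈u , b∈u) (a∈v , b∈v) =
    Equivalence.from (correct u v u≢v) ((_ , a∈u , a∈v) , (_ , b∈u , b∈v))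

  carried-once : ∀ {p ab} (I : IndependentSet G p) {i i'} →
    Carries (vertex I i) ab → Carries (vertex I i') ab → i ≡ i'
  carried-once I {i} {i'} ci ci' with i Fin.≟ i'
  ... | yes i≡i' = i≡i'
  ... | no i≢i' = ⊥-elim (independent I i i' (common-pair⇒adjacent (i≢i' ∘ injective I) ci ci'))

  -- If two independent sets of sizes p and q span a complete bipartite subgraph,
  -- then pq ≤ αβ: witnessing each of its edges is an injection into 𝒜 × ℬ.
  biclique-bound : ∀ {p q} (I : IndependentSet G p) (J : IndependentSet G q) →
    (∀ i j → Adj G (vertex I i) (vertex J j)) → p * q ≤ α * β
  biclique-bound {p} {q} I J complete = product-injection-bound witness witness-injective
    where
      witness : Fin p × Fin q → Fin α × Fin β
      witness (i , j) = proj₁ (edge-witness (complete i j))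

      carried : ∀ i j →
        Carries (vertex I i) (witness (i , j)) × Carries (vertex J j) (witness (i , j))
      carried i j = proj₂ (edge-witness (complete i j))

      witness-injective : Injective _≡_ _≡_ witness
      witness-injective {i , j} {i' , j'} e = cong₂ _,_
        (carried-once I (proj₁ (carried i j)) (subst (Carries _) (sym e) (proj₁ (carried i' j'))))
        (carried-once J (proj₂ (carried i j)) (subst (Carries _) (sym e) (proj₂ (carried i' j'))))

-- The complete tripartite graph K_{n,n,n}, whose vertex u is the pair (part, index)
-- given by quotient and remainder of u by n.
module _ (n : ℕ) .{{_ : NonZero n}} where

  part : Fin (3 * n) → Fin 3
  part = quotient {3} n

  part-toℕ : ∀ u → toℕ u / n ≡ toℕ (part u)
  part-toℕ u = begin
    toℕ u / n                  ≡⟨ /-congˡ (cong toℕ (sym (FinP.combine-remQuot {3} n u))) ⟩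
    toℕ (combine q r) / n      ≡⟨ /-congˡ (FinP.toℕ-combine q r) ⟩
    (n * toℕ q + toℕ r) / n    ≡⟨ +-distrib-/-∣ˡ (toℕ r) (m∣m*n (toℕ q)) ⟩
    n * toℕ q / n + toℕ r / n  ≡⟨ cong₂ _+_ nq/n≡q (m<n⇒m/n≡0 (FinP.toℕ<n r)) ⟩
    toℕ q + 0                  ≡⟨ +-identityʳ (toℕ q) ⟩
    toℕ q                      ∎
    where
      open ≡-Reasoning
      q = part u
      r = remainder {3} n u
      nq/n≡q : n * toℕ q / n ≡ toℕ q
      nq/n≡q = trans (/-congˡ (*-comm n (toℕ q))) (m*n/n≡m (toℕ q) n)

  K3-adjacency : ∀ {u v} → Adj (K3 n) u v ⇔ part u ≢ part v
  K3-adjacency {u} {v} = mk⇔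
    (λ adj same → adj (trans (part-toℕ u) (trans (cong toℕ same) (sym (part-toℕ v)))))
    (λ differ same →
       differ (FinP.toℕ-injective (trans (sym (part-toℕ u)) (trans same (part-toℕ v)))))

  part-combine : ∀ c (i : Fin n) → part (combine c i) ≡ c
  part-combine c i = cong proj₁ (FinP.remQuot-combine c i)

  partSet : Fin 3 → IndependentSet (K3 n) n
  partSet c = record
    { vertex      = combine c
    ; injective   = λ {i} {i'} e → proj₂ (FinP.combine-injective c i c i' e)
    ; independent = λ i i' adj →
        Equivalence.to K3-adjacency adj (trans (part-combine c i) (sym (part-combine c i')))
    }

  K3-lower : ∀ {α β} → CIR (K3 n) α β → n * n ≤ α * β
  K3-lower R = biclique-bound R (partSet 0F) (partSet 1F) λ i j →
    Equivalence.from K3-adjacency λ same →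
      0F≢1F (trans (sym (part-combine 0F i)) (trans same (part-combine 1F j)))
    where
      0F≢1F : 0F ≢ 1F
      0F≢1F ()

fibre : ∀ {N k} → (Fin N → Fin k) → Fin k → Subset N
fibre f i = tabulate λ x → ⌊ f x Fin.≟ i ⌋

∈-fibre : ∀ {N k} {f : Fin N → Fin k} {i x} → x ∈ fibre f i ⇔ f x ≡ i
∈-fibre {f = f} {i} {x} = mk⇔
  (λ x∈ → toWitness {a? = f x Fin.≟ i}
     (Equivalence.from T-≡ (trans (sym (lookup∘tabulate _ x)) ([]=⇒lookup x∈))))
  (λ fx≡i → lookup⇒[]= x (fibre f i)
     (trans (lookup∘tabulate _ x) (Equivalence.to T-≡ (fromWitness fx≡i))))

fibres-meet : ∀ {N k} {f g : Fin N → Fin k} {i j} →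
  Meets (fibre f i) (fibre g j) ⇔ (∃[ x ] (f x ≡ i × g x ≡ j))
fibres-meet = mk⇔
  (λ (x , x∈fi , x∈gj) → x , Equivalence.to ∈-fibre x∈fi , Equivalence.to ∈-fibre x∈gj)
  (λ (x , fx≡i , gx≡j) → x , Equivalence.from ∈-fibre fx≡i , Equivalence.from ∈-fibre gx≡j)

fibres-disjoint : ∀ {N k} {f : Fin N → Fin k} {i j} → Meets (fibre f i) (fibre f j) → i ≡ j
fibres-disjoint m with _ , fx≡i , fx≡j ← Equivalence.to fibres-meet m = trans (sym fx≡i) fx≡j

record OrthogonalArray (N k : ℕ) : Set where
  field
    coord      : Fin 3 → Fin N → Fin k
    orthogonal : ∀ {c c'} → c ≢ c' → ∀ i i' → ∃[ x ] (coord c x ≡ i × coord c' x ≡ i')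

module _ {N k} .{{_ : NonZero k}} (T : OrthogonalArray N k) where
  open OrthogonalArray T

  private instance
    k²≢0 : NonZero (k * k)
    k²≢0 = m*n≢0 k k

  -- A vertex of K_{k²,k²,k²} is a part together with an index
  -- (first , second) ∈ Fin k × Fin k.
  first second : Fin (3 * (k * k)) → Fin k
  first  u = quotient  {k} k (remainder {3} (k * k) u)
  second u = remainder {k} k (remainder {3} (k * k) u)

  decode-injective : ∀ {u v : Fin (3 * (k * k))} → part (k * k) u ≡ part (k * k) v →
    first u ≡ first v → second u ≡ second v → u ≡ v
  decode-injective same-part same-first same-second =
    remQuot-injective {3}
      (cong₂ _,_ same-part (remQuot-injective {k} (cong₂ _,_ same-first same-second)))

  -- The vertex u receives the fibres of the coordinate of its part over its two indices:
  -- across parts the fibres meet by orthogonality, within a part they meet only if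
  -- the indices agree.
  orthogonal⇒CIR : CIR (K3 (k * k)) N N
  orthogonal⇒CIR = record
    { A       = λ u → fibre (coord (part (k * k) u)) (first u)
    ; B       = λ u → fibre (coord (part (k * k) u)) (second u)
    ; correct = λ u v u≢v → mk⇔
        (λ adj → let differ = Equivalence.to (K3-adjacency (k * k)) adj in
           Equivalence.from fibres-meet (orthogonal differ (first u) (first v)) ,
           Equivalence.from fibres-meet (orthogonal differ (second u) (second v)))
        (λ (meetA , meetB) → Equivalence.from (K3-adjacency (k * k)) λ same →
           u≢v (decode-injective same (fibres-agree same meetA) (fibres-agree same meetB)))
    }
    where
      fibres-agree : ∀ {c c' i i'} → c ≡ c' →
        Meets (fibre (coord c) i) (fibre (coord c') i') → i ≡ i'
      fibres-agree refl = fibres-disjoint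

[m+n%d]%d≡[m+n]%d : ∀ m n d .{{_ : NonZero d}} → (m + n % d) % d ≡ (m + n) % d
[m+n%d]%d≡[m+n]%d m n d = begin
  (m + n % d) % d          ≡⟨ %-distribˡ-+ m (n % d) d ⟩
  (m % d + n % d % d) % d  ≡⟨ cong (λ t → (m % d + t) % d) (m%n%n≡m%n n d) ⟩
  (m % d + n % d) % d      ≡⟨ %-distribˡ-+ m n d ⟨
  (m + n) % d              ∎
  where open ≡-Reasoning

module _ (k : ℕ) .{{_ : NonZero k}} where

  _⊕_ : Fin k → Fin k → Fin k
  x ⊕ y = (toℕ x + toℕ y) mod k

  ⊕-comm : ∀ x y → x ⊕ y ≡ y ⊕ x
  ⊕-comm x y = cong (λ m → m mod k) (+-comm (toℕ x) (toℕ y))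

  -- Every equation x ⊕ y ≡ z is solvable, by y = (z + (k ∸ x)) mod k: so each row
  -- of the addition table is a permutation.
  ⊕-solvable : ∀ x z → ∃[ y ] (x ⊕ y ≡ z)
  ⊕-solvable x z = w mod k , FinP.toℕ-injective (begin
    toℕ (x ⊕ (w mod k))          ≡⟨ FinP.toℕ-fromℕ< _ ⟩
    (toℕ x + toℕ (w mod k)) % k  ≡⟨ cong (λ t → (toℕ x + t) % k) (FinP.toℕ-fromℕ< _) ⟩
    (toℕ x + w % k) % k          ≡⟨ [m+n%d]%d≡[m+n]%d (toℕ x) w k ⟩
    (toℕ x + w) % k              ≡⟨ %-congˡ x+w≡z+k ⟩
    (toℕ z + k) % k              ≡⟨ [m+n]%n≡m%n (toℕ z) k ⟩
    toℕ z % k                    ≡⟨ m<n⇒m%n≡m (FinP.toℕ<n z) ⟩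
    toℕ z                        ∎)
    where
      open ≡-Reasoning
      w = toℕ z + (k ∸ toℕ x)
      x+w≡z+k : toℕ x + w ≡ toℕ z + k
      x+w≡z+k = begin
        toℕ x + (toℕ z + (k ∸ toℕ x))  ≡⟨ +-assoc (toℕ x) (toℕ z) _ ⟨
        toℕ x + toℕ z + (k ∸ toℕ x)    ≡⟨ cong (_+ (k ∸ toℕ x)) (+-comm (toℕ x) (toℕ z)) ⟩
        toℕ z + toℕ x + (k ∸ toℕ x)    ≡⟨ +-assoc (toℕ z) (toℕ x) _ ⟩
        toℕ z + (toℕ x + (k ∸ toℕ x))  ≡⟨ cong (toℕ z +_) (m+[n∸m]≡n (<⇒≤ (FinP.toℕ<n x))) ⟩
        toℕ z + k                      ∎

  row column symbol : Fin (k * k) → Fin k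
  row    = quotient {k} k
  column = remainder {k} k
  symbol x = row x ⊕ column x

  cell-coordinates : ∀ a b → row (combine a b) ≡ a × column (combine a b) ≡ b
  cell-coordinates a b = ,-injective (FinP.remQuot-combine a b)

  cell-symbol : ∀ a b → symbol (combine a b) ≡ a ⊕ b
  cell-symbol a b = uncurry (cong₂ _⊕_) (cell-coordinates a b)

  row-column : ∀ a b → ∃[ x ] (row x ≡ a × column x ≡ b)
  row-column a b = combine a b , cell-coordinates a b

  row-symbol : ∀ a s → ∃[ x ] (row x ≡ a × symbol x ≡ s)
  row-symbol a s with b , a⊕b≡s ← ⊕-solvable a s =
    combine a b , proj₁ (cell-coordinates a b) , trans (cell-symbol a b) a⊕b≡s

  column-symbol : ∀ b s → ∃[ x ] (column x ≡ b × symbol x ≡ s)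
  column-symbol b s with a , b⊕a≡s ← ⊕-solvable b s =
    combine a b , proj₂ (cell-coordinates a b) , trans (cell-symbol a b) (trans (⊕-comm a b) b⊕a≡s)

  cyclicArray : OrthogonalArray (k * k) k
  cyclicArray = record { coord = coord ; orthogonal = orthogonal }
    where
      coord : Fin 3 → Fin (k * k) → Fin k
      coord 0F = row
      coord 1F = column
      coord 2F = symbol

      orthogonal : ∀ {c c'} → c ≢ c' → ∀ i i' → ∃[ x ] (coord c x ≡ i × coord c' x ≡ i')
      orthogonal {0F} {1F} _ = row-column
      orthogonal {0F} {2F} _ = row-symbol
      orthogonal {1F} {2F} _ = column-symbol
      orthogonal {1F} {0F} _ i i' = map₂ swap (row-column i' i)
      orthogonal {2F} {0F} _ i i' = map₂ swap (row-symbol i' i)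
      orthogonal {2F} {1F} _ i i' = map₂ swap (column-symbol i' i)
      orthogonal {0F} {0F} c≢c = contradiction refl c≢c
      orthogonal {1F} {1F} c≢c = contradiction refl c≢c
      orthogonal {2F} {2F} c≢c = contradiction refl c≢c

corollary4 : (m : ℕ) → let k = 2 + m in
    CointersectionNumber (K3 (k * k)) (2 * (k * k))
corollary4 m = (n , n , orthogonal⇒CIR (cyclicArray k) , n+n≡2n)
             , λ α β R → square-bound n α β (K3-lower n R)
  where
    k n : ℕ
    k = 2 + m
    n = k * k
    n+n≡2n : n + n ≡ 2 * n
    n+n≡2n = cong (n +_) (sym (+-identityʳ n))
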